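{- Suppose that a fractal $\mathsf{PHHF}(3;\kappa,(w_1,w_2,w_3),3)$ exists and $n\ge 6$. Then: (i) for every integer $k\ge 1$, a $\mathsf{PHHF}(n;6\kappa+(n-6)k,(3\kappa+(n-6)k+w_1+w_2+w_3)^6(6\kappa+(n-7)k+1)^{n-6},2n-4)$ exists; (ii) if $w_1+w_2+w_3\le\kappa$, a $\mathsf{PHF}(n;(3n-12)\kappa-(n-6)(w_1+w_2+w_3-1),(3n-15)\kappa-(n-7)(w_1+w_2+w_3-1)+1,2n-4)$ exists.
   Context: An $\mathsf{HHF}(N;k,(w_1,\dots,w_N))$ is an $N\times k$ array in which row $i$ contains at most $w_i$ distinct symbols. Given a set $S$ of columns and a partition of $S$ into $p$ classes (some possibly empty), a row $r$ separates it if any two columns in distinct classes have distinct entries in row $r$. A $\mathsf{DHHF}(N;k,(w_1,\dots,w_N),t,p)$ is an $\mathsf{HHF}(N;k,(w_1,\dots,w_N))$ in which every partition of every $t$-set of columns into $p$ classes is separated by some row. A $\mathsf{PHHF}(N;k,(w_1,\dots,w_N),t)$ is a $\mathsf{DHHF}(N;k,(w_1,\dots,w_N),t,t)$; when all $w_i=w$ it is written $\mathsf{PHF}(N;k,w,t)$. A $\mathsf{DHHF}(t;k,(v_1,\dots,v_t),t,p)$ is fractal if $t\le 2$, or if for each row $j$, deleting row $j$ yields a fractal $\mathsf{DHHF}(t-1;k,(v_1,\dots,v_{j-1},v_{j+1},\dots,v_t),t-1,\min(p,t-1))$; a fractal $\mathsf{PHHF}$ is a fractal $\mathsf{DHHF}$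 with $p=t$. Exponential notation $x_1^{u_1}\cdots x_c^{u_c}$ for the symbol-count vector means the $\sum u_i$ rows can be partitioned into classes, the $i$th class consisting of $u_i$ rows each containing at most $x_i$ symbols. -}

module Defs where

open import Data.Nat using (ℕ; zero; suc; _+_; _*_; _∸_; _⊓_; _<_; _≤_)
open import Data.Fin as Fin using (Fin; toℕ; punchIn)
import Data.Nat
import Relation.Nullary
open import Data.Product using (Σ; _×_; ∃; _,_)
open import Data.Unit using (⊤)
open import Data.Integer as ℤ using (ℤ)
open import Relation.Binary.PropositionalEquality using (_≡_; _≢_)
open import Relation.Nullary using (¬_)
open import Function.Definitions using (Injective)

HHF : (N k : ℕ) → (Fin N → ℕ) → Set
HHF N k w = (i : Fin N) → Fin k → Fin (w i)

-- A t-set of columns is given as an injective map Fin t → Fin k, and a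
-- partition of it into p classes (some possibly empty) as a map Fin t → Fin p.
-- Row r separates (cols, cls) if columns in distinct classes get distinct
-- entries in row r.
Separates : ∀ {N k t p} {w : Fin N → ℕ} → HHF N k w → Fin N →
            (Fin t → Fin k) → (Fin t → Fin p) → Set
Separates A r cols cls = ∀ a b → cls a ≢ cls b → A r (cols a) ≢ A r (cols b)

IsDHHF : ∀ {N k} {w : Fin N → ℕ} → HHF N k w → (t p : ℕ) → Set
IsDHHF {N} {k} A t p =
  (cols : Fin t → Fin k) → Injective _≡_ _≡_ cols →
  (cls : Fin t → Fin p) → ∃ λ (r : Fin N) → Separates A r cols cls

IsPHHF : ∀ {N k} {w : Fin N → ℕ} → HHF N k w → (t : ℕ) → Set
IsPHHF A t = IsDHHF A t t

PHHFExists : (N k : ℕ) → (Fin N → ℕ) → (t : ℕ) → Set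
PHHFExists N k w t = Σ (HHF N k w) λ A → IsPHHF A t

PHFExists : (N k v t : ℕ) → Set
PHFExists N k v t = PHHFExists N k (λ _ → v) t

deleteRow : ∀ {t k} {w : Fin (suc t) → ℕ} (j : Fin (suc t)) →
            HHF (suc t) k w → HHF t k (λ i → w (punchIn j i))
deleteRow j A i = A (punchIn j i)

FractalDel : ∀ (t : ℕ) {k} {w : Fin t → ℕ} → HHF t k w → ℕ → Set
IsFractal  : ∀ (t : ℕ) {k} {w : Fin t → ℕ} → HHF t k w → ℕ → Set

IsFractal t A p = IsDHHF A t p × FractalDel t A p

FractalDel zero A p = ⊤
FractalDel (suc zero) A p = ⊤
FractalDel (suc (suc zero)) A p = ⊤
FractalDel (suc (suc (suc t))) A p =
  ∀ (j : Fin (suc (suc (suc t)))) →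
    IsFractal (suc (suc t)) (deleteRow j A) (p ⊓ suc (suc t))

vec3 : ℕ → ℕ → ℕ → Fin 3 → ℕ
vec3 a b c Fin.zero = a
vec3 a b c (Fin.suc Fin.zero) = b
vec3 a b c (Fin.suc (Fin.suc Fin.zero)) = c

FractalPHHF3Exists : ℕ → ℕ → ℕ → ℕ → Set
FractalPHHF3Exists κ w1 w2 w3 =
  Σ (HHF 3 κ (vec3 w1 w2 w3)) λ A → IsFractal 3 A 3

sixThen : (n a b : ℕ) → Fin n → ℕ
sixThen n a b i with toℕ i Data.Nat.<? 6
... | Relation.Nullary.yes _ = a
... | Relation.Nullary.no _ = b

-- The array has n = 6 + m rows and two kinds of columns: six groups of κ columns, each a copy of
-- the columns of the fractal array F, and m groups of k columns.  In main row r the columns of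
-- group g carry row i of F when g − r is the i-th element of {0, 1, 3} modulo 6 (all groups
-- carrying row i share its w_i symbols), and fresh symbols otherwise; extra row j gives the
-- k columns of group j a single common symbol and every other column a symbol of its own.
--
-- Suppose a partition of t columns into classes is separated by no row.  Each extra row then
-- forces two of the t columns into its group, and each main row forces two columns of a single
-- group into different classes although their columns of F agree in some row of F.  Two columns
-- of F agree in at most one row (by fractality) and any three are separated by some row, so a
-- group on which s ≥ 1 rows of F are forced holds at least s + 1 of the t columns.  No two
-- translates of {0, 1, 3} partition ℤ/6, so the six main rows hit at least three groups, whence
-- t ≥ (6 + 3) + 2m = 2n − 3.

module Submission where

open import Defs
open import Data.Nat as ℕ using (ℕ; zero; suc; _+_; _*_; _∸_; _≤_; z≤n; s≤s)
import Data.Nat.Properties as ℕₚ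
open ℕₚ using (+-0-commutativeMonoid; ≤-refl; ≤-trans; +-mono-≤; m≤n⇒m≤o+n)
import Data.Nat.Tactic.RingSolver as ℕ-Solver
open import Data.Nat.DivMod using (_mod_)
open import Data.Integer as ℤ using (ℤ; +_)
open import Data.Integer.Properties using (pos-+; pos-*; ⊖-≥; m-n≡m⊖n; +-injective)
open import Data.Integer.Tactic.RingSolver using (solve-∀)
open import Data.Fin as Fin using (Fin; zero; suc; toℕ; punchIn; punchOut; _↑ˡ_; _↑ʳ_)
open import Data.Fin.Patterns
open import Data.Fin.Properties as Finₚ using (any?; all?)
open import Data.Bool using (Bool; true; false; T; if_then_else_)
open import Data.Vec.Functional using (Vector; _∷_; [])
open import Data.Product using (∃; ∃₂; _×_; _,_; proj₁; proj₂; uncurry)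
open import Data.Sum using (_⊎_; inj₁; inj₂)
open import Data.Empty using (⊥; ⊥-elim)
open import Function using (_∘_; id)
open import Function.Definitions using (Injective)
open import Relation.Nullary using (Dec; yes; no; does)
open import Relation.Nullary.Decidable
  using (isYes; from-yes; toWitness; _→-dec_; _⊎-dec_; _×-dec_; ¬?)
open import Relation.Unary using (Pred; Decidable)
open import Relation.Binary.PropositionalEquality
open import Algebra.Properties.CommutativeMonoid.Sum +-0-commutativeMonoid
  using (sum; sum-syntax; ∑-comm; sum-cong-≗)

retraction⇒injective : ∀ {A B : Set} (f : A → B) (g : B → A) →
                       (∀ x → g (f x) ≡ x) → Injective _≡_ _≡_ f
retraction⇒injective f g gf {x} {y} fx≡fy =
  trans (sym (gf x)) (trans (cong g fx≡fy) (gf y))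

[]-injective : ∀ {A : Set} → Injective _≡_ _≡_ ([] {A = A})
[]-injective {x = ()}

∷-injective : ∀ {A : Set} {n} {x : A} {xs : Vector A n} →
              (∀ i → x ≢ xs i) → Injective _≡_ _≡_ xs → Injective _≡_ _≡_ (x ∷ xs)
∷-injective x∉xs xs-inj {zero}  {zero}  _ = refl
∷-injective x∉xs xs-inj {zero}  {suc j} e = ⊥-elim (x∉xs j e)
∷-injective x∉xs xs-inj {suc i} {zero}  e = ⊥-elim (x∉xs i (sym e))
∷-injective x∉xs xs-inj {suc i} {suc j} e = cong suc (xs-inj e)

pair-injective : ∀ {A : Set} {x y : A} → x ≢ y → Injective _≡_ _≡_ (x ∷ y ∷ [])
pair-injective x≢y = ∷-injective (λ { 0F → x≢y }) (∷-injective (λ ()) []-injective)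

Fin2-≢⇒≡ : ∀ {A : Set} (f : Fin 2 → A) {u v} → u ≢ v → f u ≡ f v → f 0F ≡ f 1F
Fin2-≢⇒≡ f {0F} {0F} u≢v _ = ⊥-elim (u≢v refl)
Fin2-≢⇒≡ f {0F} {1F} _   e = e
Fin2-≢⇒≡ f {1F} {0F} _   e = sym e
Fin2-≢⇒≡ f {1F} {1F} u≢v _ = ⊥-elim (u≢v refl)

punchOut′ : ∀ {m} {i j : Fin m} → i ≢ j → Fin (m ∸ 1)
punchOut′ {suc m} i≢j = punchOut i≢j

punchOut′-injective : ∀ {m} {i j j′ : Fin m} (i≢j : i ≢ j) (i≢j′ : i ≢ j′) →
                      punchOut′ i≢j ≡ punchOut′ i≢j′ → j ≡ j′
punchOut′-injective {suc m} = Finₚ.punchOut-injective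

∃⊎∀ : ∀ {n p q} {P : Pred (Fin n) p} {Q : Pred (Fin n) q} →
      (∀ i → P i ⊎ Q i) → ∃ P ⊎ (∀ i → Q i)
∃⊎∀ {zero}  P⊎Q = inj₂ λ ()
∃⊎∀ {suc n} P⊎Q with P⊎Q zero | ∃⊎∀ (P⊎Q ∘ suc)
... | inj₁ P0 | _             = inj₁ (zero , P0)
... | inj₂ _  | inj₁ (i , Pi) = inj₁ (suc i , Pi)
... | inj₂ Q0 | inj₂ Qsuc     = inj₂ λ { zero → Q0 ; (suc i) → Qsuc i }

indicator : ∀ {a} {A : Set a} → Dec A → ℕ
indicator d = if does d then 1 else 0

count : ∀ {t p} {P : Pred (Fin t) p} → Decidable P → ℕ
count {t} P? = ∑[ x < t ] indicator (P? x)

∑-const : ∀ n c → ∑[ i < n ] c ≡ n * c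
∑-const zero    c = refl
∑-const (suc n) c = cong (_+_ c) (∑-const n c)

∑-mono-≤ : ∀ {n} {f g : Vector ℕ n} → (∀ i → f i ≤ g i) → sum f ≤ sum g
∑-mono-≤ {zero}  f≤g = z≤n
∑-mono-≤ {suc n} f≤g = +-mono-≤ (f≤g zero) (∑-mono-≤ (f≤g ∘ suc))

∑-≥ : ∀ {n} c {f : Vector ℕ n} → (∀ i → c ≤ f i) → n * c ≤ sum f
∑-≥ {n} c c≤f = ≤-trans (ℕₚ.≤-reflexive (sym (∑-const n c))) (∑-mono-≤ c≤f)

∑-↑ : ∀ a {b} (f : Vector ℕ (a + b)) →
      sum f ≡ ∑[ i < a ] f (i ↑ˡ b) + ∑[ j < b ] f (a ↑ʳ j)
∑-↑ zero    f = refl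
∑-↑ (suc a) f = trans (cong (_+_ (f zero)) (∑-↑ a (f ∘ suc))) (sym (ℕₚ.+-assoc (f zero) _ _))

∑-indicator-≟ : ∀ {u} (a : Fin u) → ∑[ q < u ] indicator (a Fin.≟ q) ≡ 1
∑-indicator-≟ {suc u} zero    = cong suc (trans (∑-const u 0) (ℕₚ.*-zeroʳ u))
∑-indicator-≟ {suc u} (suc a) = ∑-indicator-≟ a

∑-count-fibres : ∀ {t u} (key : Fin t → Fin u) → ∑[ q < u ] count (λ x → key x Fin.≟ q) ≡ t
∑-count-fibres {t} {u} key = begin
  ∑[ q < u ] ∑[ x < t ] indicator (key x Fin.≟ q) ≡⟨ ∑-comm (λ q x → indicator (key x Fin.≟ q)) ⟩
  ∑[ x < t ] ∑[ q < u ] indicator (key x Fin.≟ q) ≡⟨ sum-cong-≗ (∑-indicator-≟ ∘ key) ⟩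
  ∑[ x < t ] 1                                     ≡⟨ ∑-const t 1 ⟩
  t * 1                                            ≡⟨ ℕₚ.*-identityʳ t ⟩
  t                                                ∎
  where open ≡-Reasoning

≤-count : ∀ {s t p} {P : Pred (Fin t) p} (P? : Decidable P) (f : Fin s → Fin t) →
          Injective _≡_ _≡_ f → (∀ i → P (f i)) → s ≤ count P?

≤-count-suc : ∀ {s t p} {P : Pred (Fin (suc t)) p} (P? : Decidable P)
              (f : Fin s → Fin (suc t)) → Injective _≡_ _≡_ f → (∀ i → P (f i)) →
              (∀ i → zero ≢ f i) → s ≤ count (P? ∘ suc)
≤-count-suc {P = P} P? f f-inj Pf f≢0 = ≤-count (P? ∘ suc) (λ i → punchOut (f≢0 i))
  (λ e → f-inj (Finₚ.punchOut-injective (f≢0 _) (f≢0 _) e))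
  (λ i → subst P (sym (Finₚ.punchIn-punchOut (f≢0 i))) (Pf i))

≤-count {zero}          P? f f-inj Pf = z≤n
≤-count {suc s} {zero}  P? f f-inj Pf with f zero
... | ()
≤-count {suc s} {suc t} {P = P} P? f f-inj Pf with any? (λ i → f i Fin.≟ zero)
... | no 0∉f = m≤n⇒m≤o+n (indicator (P? zero)) (≤-count-suc P? f f-inj Pf λ i e → 0∉f (i , sym e))
... | yes (i₀ , fi₀≡0) with P? zero
...   | no ¬P0 = ⊥-elim (¬P0 (subst P fi₀≡0 (Pf i₀)))
...   | yes _  = s≤s (≤-count-suc P? (f ∘ punchIn i₀)
                       (Finₚ.punchIn-injective i₀ _ _ ∘ f-inj) (Pf ∘ punchIn i₀)
                       λ i e → Finₚ.punchInᵢ≢i i₀ i (f-inj (trans (sym e) (sym fi₀≡0))))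

Collision : ∀ {N k t p} {w : Fin N → ℕ} →
            HHF N k w → Fin N → (Fin t → Fin k) → (Fin t → Fin p) → Set
Collision A r cols cls = ∃₂ λ a b → cls a ≢ cls b × A r (cols a) ≡ A r (cols b)

separates-or-collides : ∀ {N k t p} {w : Fin N → ℕ} (A : HHF N k w) r
                        (cols : Fin t → Fin k) (cls : Fin t → Fin p) →
                        Separates A r cols cls ⊎ Collision A r cols cls
separates-or-collides A r cols cls
  with any? (λ a → any? (λ b → ¬? (cls a Fin.≟ cls b) ×-dec (A r (cols a) Fin.≟ A r (cols b))))
... | yes (a , b , split , same) = inj₂ (a , b , split , same)
... | no  none                    = inj₁ λ a b split same → none (a , b , split , same)

PHHFExists-mono : ∀ {N k t} {w v : Fin N → ℕ} → (∀ i → w i ≤ v i) →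
                  PHHFExists N k w t → PHHFExists N k v t
PHHFExists-mono w≤v (A , A-phhf) =
  (λ i x → Fin.inject≤ (A i x) (w≤v i)) ,
  λ cols cols-inj cls → let (r , sep) = A-phhf cols cols-inj cls in
    r , λ a b split same → sep a b split (Finₚ.inject≤-injective (w≤v r) (w≤v r) _ _ same)

sixThen-≤ : ∀ {n a b v} → a ≤ v → (7 ≤ n → b ≤ v) → ∀ i → sixThen n a b i ≤ v
sixThen-≤ a≤v b≤v i with toℕ i ℕ.<? 6
... | yes _   = a≤v
... | no i≮6 = b≤v (ℕₚ.≤-trans (s≤s (ℕₚ.≮⇒≥ i≮6)) (Finₚ.toℕ<n i))

otherTwoRows : ∀ (i j : Fin 3) → i ≢ j → ∃ λ l → ∀ r → punchIn l r ≡ i ⊎ punchIn l r ≡ j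
otherTwoRows = from-yes (all? λ i → all? λ j → ¬? (i Fin.≟ j) →-dec
  any? λ (l : Fin 3) → all? λ r → punchIn l r Fin.≟ i ⊎-dec punchIn l r Fin.≟ j)

fractal-agree-at-most-once : ∀ {κ} {w : Fin 3 → ℕ} {F : HHF 3 κ w} → IsFractal 3 F 3 →
                             ∀ {c c′ i j} → c ≢ c′ → i ≢ j → F i c ≡ F i c′ → F j c ≢ F j c′
fractal-agree-at-most-once (_ , restrictions) {c} {c′} c≢c′ i≢j Fi Fj
  with otherTwoRows _ _ i≢j
... | l , covers with proj₁ (restrictions l) (c ∷ c′ ∷ []) (pair-injective c≢c′) id
... | r , separated with covers r
... | inj₁ refl = separated 0F 1F (λ ()) Fi
... | inj₂ refl = separated 0F 1F (λ ()) Fj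

data Cell : Set where
  fractal : Fin 3 → Cell
  fresh   : Fin 3 → Cell

cellAt : Fin 6 → Cell
cellAt 0F = fractal 0F
cellAt 1F = fractal 1F
cellAt 2F = fresh 0F
cellAt 3F = fractal 2F
cellAt 4F = fresh 1F
cellAt 5F = fresh 2F

cellIndex : Cell → Fin 6
cellIndex (fractal 0F) = 0F
cellIndex (fractal 1F) = 1F
cellIndex (fractal 2F) = 3F
cellIndex (fresh 0F)   = 2F
cellIndex (fresh 1F)   = 4F
cellIndex (fresh 2F)   = 5F

cellAt-injective : Injective _≡_ _≡_ cellAt
cellAt-injective = retraction⇒injective cellAt cellIndex
  λ { 0F → refl ; 1F → refl ; 2F → refl ; 3F → refl ; 4F → refl ; 5F → refl }

cellAt-cellIndex-fractal : ∀ i → cellAt (cellIndex (fractal i)) ≡ fractal i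
cellAt-cellIndex-fractal 0F = refl
cellAt-cellIndex-fractal 1F = refl
cellAt-cellIndex-fractal 2F = refl

offset : Fin 6 → Fin 6 → Fin 6
offset r g = (6 + toℕ g ∸ toℕ r) mod 6

cell : Fin 6 → Fin 6 → Cell
cell r g = cellAt (offset r g)

groupOf : Fin 6 → Fin 3 → Fin 6
groupOf r i = (toℕ r + toℕ (cellIndex (fractal i))) mod 6

rowOf : Fin 6 → Fin 3 → Fin 6
rowOf g i = (6 + toℕ g ∸ toℕ (cellIndex (fractal i))) mod 6

cell-injective : ∀ r {g g′} → cell r g ≡ cell r g′ → g ≡ g′
cell-injective r {g} {g′} = offset-injective r g g′ ∘ cellAt-injective
  where
  offset-injective : ∀ r g g′ → offset r g ≡ offset r g′ → g ≡ g′
  offset-injective = from-yes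
    (all? λ r → all? λ g → all? λ g′ → offset r g Fin.≟ offset r g′ →-dec g Fin.≟ g′)

cell-groupOf : ∀ r i → cell r (groupOf r i) ≡ fractal i
cell-groupOf r i = trans (cong cellAt (offset-groupOf r i)) (cellAt-cellIndex-fractal i)
  where
  offset-groupOf : ∀ r i → offset r (groupOf r i) ≡ cellIndex (fractal i)
  offset-groupOf = from-yes
    (all? λ r → all? λ i → offset r (groupOf r i) Fin.≟ cellIndex (fractal i))

cell≡fractal⇒groupOf : ∀ r {g} i → cell r g ≡ fractal i → g ≡ groupOf r i
cell≡fractal⇒groupOf r i e = cell-injective r (trans e (sym (cell-groupOf r i)))

groupOf-rowOf : ∀ g i → groupOf (rowOf g i) i ≡ g
groupOf-rowOf = from-yes (all? λ g → all? λ i → groupOf (rowOf g i) i Fin.≟ g)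

flagBound : Bool → Bool → Bool → ℕ
flagBound false false false = 0
flagBound true  false false = 2
flagBound false true  false = 2
flagBound false false true  = 2
flagBound true  true  false = 3
flagBound true  false true  = 3
flagBound false true  true  = 3
flagBound true  true  true  = 4

flag : (Fin 6 → Fin 3) → Fin 6 → Fin 3 → Bool
flag h g i = isYes (h (rowOf g i) Fin.≟ i)

groupBoundSum : (Fin 6 → Fin 3) → ℕ
groupBoundSum h = ∑[ g < 6 ] flagBound (flag h g 0F) (flag h g 1F) (flag h g 2F)

-- Checked over all 3⁶ maps h; groupBoundSum h is 6 plus the number of groups that h hits.
9≤groupBoundSum : ∀ h → 9 ≤ groupBoundSum h
9≤groupBoundSum h = all-maps (h 0F) (h 1F) (h 2F) (h 3F) (h 4F) (h 5F)
  where
  all-maps : ∀ h₀ h₁ h₂ h₃ h₄ h₅ → 9 ≤ groupBoundSum (h₀ ∷ h₁ ∷ h₂ ∷ h₃ ∷ h₄ ∷ h₅ ∷ [])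
  all-maps = from-yes (all? λ h₀ → all? λ h₁ → all? λ h₂ → all? λ h₃ → all? λ h₄ → all? λ h₅ →
    9 ℕ.≤? groupBoundSum (h₀ ∷ h₁ ∷ h₂ ∷ h₃ ∷ h₄ ∷ h₅ ∷ []))

module Construction {κ} {w : Fin 3 → ℕ} (F : HHF 3 κ w) (m k : ℕ) where

  data Column : Set where
    main  : Fin 6 → Fin κ → Column
    extra : Fin m → Fin k → Column

  K : ℕ
  K = 6 * κ + m * k

  encodeColumn : Column → Fin K
  encodeColumn (main g c)  = Fin.combine g c ↑ˡ (m * k)
  encodeColumn (extra j c) = (6 * κ) ↑ʳ Fin.combine j c

  decodeColumn : Fin K → Column
  decodeColumn x with Fin.splitAt (6 * κ) x
  ... | inj₁ y = uncurry main (Fin.remQuot κ y)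
  ... | inj₂ y = uncurry extra (Fin.remQuot k y)

  decodeColumn-injective : Injective _≡_ _≡_ decodeColumn
  decodeColumn-injective = retraction⇒injective decodeColumn encodeColumn encode-decode
    where
    open Finₚ using (combine-remQuot; splitAt⁻¹-↑ˡ; splitAt⁻¹-↑ʳ)
    encode-decode : ∀ x → encodeColumn (decodeColumn x) ≡ x
    encode-decode x with Fin.splitAt (6 * κ) x in eq
    ... | inj₁ y = trans (cong (_↑ˡ (m * k)) (combine-remQuot {6} κ y)) (splitAt⁻¹-↑ˡ eq)
    ... | inj₂ y = trans (cong ((6 * κ) ↑ʳ_) (combine-remQuot {m} k y)) (splitAt⁻¹-↑ʳ eq)

  main-injectiveʳ : ∀ {g g′ c c′} → main g c ≡ main g′ c′ → c ≡ c′
  main-injectiveʳ refl = refl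

  groupKey : Column → Fin (6 + m)
  groupKey (main g _)  = g ↑ˡ m
  groupKey (extra j _) = 6 ↑ʳ j

  W : ℕ
  W = w 0F + w 1F + w 2F

  data MainSymbol : Set where
    fractalSym : (i : Fin 3) → Fin (w i) → MainSymbol
    freshSym   : Fin 3 → Fin κ → MainSymbol
    extraSym   : Fin m → Fin k → MainSymbol

  encodeMain : MainSymbol → Fin (3 * κ + m * k + W)
  encodeMain (fractalSym 0F x) = (3 * κ + m * k) ↑ʳ ((x ↑ˡ w 1F) ↑ˡ w 2F)
  encodeMain (fractalSym 1F x) = (3 * κ + m * k) ↑ʳ ((w 0F ↑ʳ x) ↑ˡ w 2F)
  encodeMain (fractalSym 2F x) = (3 * κ + m * k) ↑ʳ ((w 0F + w 1F) ↑ʳ x)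
  encodeMain (freshSym s c)    = (Fin.combine s c ↑ˡ (m * k)) ↑ˡ W
  encodeMain (extraSym j c)    = ((3 * κ) ↑ʳ Fin.combine j c) ↑ˡ W

  decodeMain : Fin (3 * κ + m * k + W) → MainSymbol
  decodeMain x with Fin.splitAt (3 * κ + m * k) x
  ... | inj₁ y with Fin.splitAt (3 * κ) y
  ...   | inj₁ z = uncurry freshSym (Fin.remQuot κ z)
  ...   | inj₂ z = uncurry extraSym (Fin.remQuot k z)
  decodeMain x | inj₂ y with Fin.splitAt (w 0F + w 1F) y
  ...   | inj₂ z = fractalSym 2F z
  ...   | inj₁ z with Fin.splitAt (w 0F) z
  ...     | inj₁ z′ = fractalSym 0F z′
  ...     | inj₂ z′ = fractalSym 1F z′

  encodeMain-injective : Injective _≡_ _≡_ encodeMain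
  encodeMain-injective = retraction⇒injective encodeMain decodeMain decode-encode
    where
    open Finₚ using (splitAt-↑ˡ; splitAt-↑ʳ; remQuot-combine)
    decode-encode : ∀ s → decodeMain (encodeMain s) ≡ s
    decode-encode (fractalSym 0F x)
      rewrite splitAt-↑ʳ (3 * κ + m * k) W ((x ↑ˡ w 1F) ↑ˡ w 2F)
            | splitAt-↑ˡ (w 0F + w 1F) (x ↑ˡ w 1F) (w 2F)
            | splitAt-↑ˡ (w 0F) x (w 1F) = refl
    decode-encode (fractalSym 1F x)
      rewrite splitAt-↑ʳ (3 * κ + m * k) W ((w 0F ↑ʳ x) ↑ˡ w 2F)
            | splitAt-↑ˡ (w 0F + w 1F) (w 0F ↑ʳ x) (w 2F)
            | splitAt-↑ʳ (w 0F) (w 1F) x = refl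
    decode-encode (fractalSym 2F x)
      rewrite splitAt-↑ʳ (3 * κ + m * k) W ((w 0F + w 1F) ↑ʳ x)
            | splitAt-↑ʳ (w 0F + w 1F) (w 2F) x = refl
    decode-encode (freshSym s c)
      rewrite splitAt-↑ˡ (3 * κ + m * k) (Fin.combine s c ↑ˡ (m * k)) W
            | splitAt-↑ˡ (3 * κ) (Fin.combine s c) (m * k) =
      cong (uncurry freshSym) (remQuot-combine s c)
    decode-encode (extraSym j c)
      rewrite splitAt-↑ˡ (3 * κ + m * k) ((3 * κ) ↑ʳ Fin.combine j c) W
            | splitAt-↑ʳ (3 * κ) (m * k) (Fin.combine j c) =
      cong (uncurry extraSym) (remQuot-combine j c)

  fractalSym-injectiveˡ : ∀ {i i′ x y} → fractalSym i x ≡ fractalSym i′ y → i ≡ i′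
  fractalSym-injectiveˡ refl = refl

  fractalSym-injectiveʳ : ∀ {i x y} → fractalSym i x ≡ fractalSym i y → x ≡ y
  fractalSym-injectiveʳ refl = refl

  cellSymbol : Cell → Fin κ → MainSymbol
  cellSymbol (fractal i) c = fractalSym i (F i c)
  cellSymbol (fresh s)   c = freshSym s c

  mainEntry : Fin 6 → Column → MainSymbol
  mainEntry r (main g c)  = cellSymbol (cell r g) c
  mainEntry r (extra j c) = extraSym j c

  cellSymbol-collision : ∀ x y {c c′} → cellSymbol x c ≡ cellSymbol y c′ →
                         (x ≡ y × c ≡ c′) ⊎ (∃ λ i → x ≡ fractal i × y ≡ fractal i × F i c ≡ F i c′)
  cellSymbol-collision (fractal i) (fractal i′) e with fractalSym-injectiveˡ e
  ... | refl = inj₂ (i , refl , refl , fractalSym-injectiveʳ e)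
  cellSymbol-collision (fresh s)   (fresh s′)   refl = inj₁ (refl , refl)
  cellSymbol-collision (fractal i) (fresh s)    ()
  cellSymbol-collision (fresh s)   (fractal i)  ()

  cellSymbol≢extraSym : ∀ x {c j c′} → cellSymbol x c ≢ extraSym j c′
  cellSymbol≢extraSym (fractal i) ()
  cellSymbol≢extraSym (fresh s)   ()

  Agree : Fin 6 → Fin 3 → Column → Column → Set
  Agree g i u v = ∃₂ λ c c′ → u ≡ main g c × v ≡ main g c′ × F i c ≡ F i c′

  mainEntry-collision : ∀ r {u v} → u ≢ v → mainEntry r u ≡ mainEntry r v →
                        ∃ λ i → Agree (groupOf r i) i u v
  mainEntry-collision r {main g c} {main g′ c′} u≢v e
    with cellSymbol-collision (cell r g) (cell r g′) e
  ... | inj₁ (same-cell , refl) = ⊥-elim (u≢v (cong (λ g → main g c) (cell-injective r same-cell)))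
  ... | inj₂ (i , cell≡ , cell′≡ , agreement) =
    i , c , c′ , cong (λ g → main g c) (cell≡fractal⇒groupOf r i cell≡) ,
                 cong (λ g → main g c′) (cell≡fractal⇒groupOf r i cell′≡) , agreement
  mainEntry-collision r {main g c}  {extra j c′}  _ e = ⊥-elim (cellSymbol≢extraSym (cell r g) e)
  mainEntry-collision r {extra j c} {main g c′}   _ e =
    ⊥-elim (cellSymbol≢extraSym (cell r g) (sym e))
  mainEntry-collision r {extra j c} {extra .j .c} u≢v refl = ⊥-elim (u≢v refl)

  data ExtraSymbol : Set where
    mainSym  : Fin 6 → Fin κ → ExtraSymbol
    otherSym : Fin (m ∸ 1) → Fin k → ExtraSymbol
    ownSym   : ExtraSymbol

  encodeExtra : ExtraSymbol → Fin (6 * κ + (m ∸ 1) * k + 1)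
  encodeExtra (mainSym g c)  = (Fin.combine g c ↑ˡ ((m ∸ 1) * k)) ↑ˡ 1
  encodeExtra (otherSym j c) = ((6 * κ) ↑ʳ Fin.combine j c) ↑ˡ 1
  encodeExtra ownSym         = (6 * κ + (m ∸ 1) * k) ↑ʳ 0F

  decodeExtra : Fin (6 * κ + (m ∸ 1) * k + 1) → ExtraSymbol
  decodeExtra x with Fin.splitAt (6 * κ + (m ∸ 1) * k) x
  ... | inj₂ _ = ownSym
  ... | inj₁ y with Fin.splitAt (6 * κ) y
  ...   | inj₁ z = uncurry mainSym (Fin.remQuot κ z)
  ...   | inj₂ z = uncurry otherSym (Fin.remQuot k z)

  encodeExtra-injective : Injective _≡_ _≡_ encodeExtra
  encodeExtra-injective = retraction⇒injective encodeExtra decodeExtra decode-encode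
    where
    open Finₚ using (splitAt-↑ˡ; splitAt-↑ʳ; remQuot-combine)
    decode-encode : ∀ s → decodeExtra (encodeExtra s) ≡ s
    decode-encode (mainSym g c)
      rewrite splitAt-↑ˡ (6 * κ + (m ∸ 1) * k) (Fin.combine g c ↑ˡ ((m ∸ 1) * k)) 1
            | splitAt-↑ˡ (6 * κ) (Fin.combine g c) ((m ∸ 1) * k) =
      cong (uncurry mainSym) (remQuot-combine g c)
    decode-encode (otherSym j c)
      rewrite splitAt-↑ˡ (6 * κ + (m ∸ 1) * k) ((6 * κ) ↑ʳ Fin.combine j c) 1
            | splitAt-↑ʳ (6 * κ) ((m ∸ 1) * k) (Fin.combine j c) =
      cong (uncurry otherSym) (remQuot-combine j c)
    decode-encode ownSym rewrite splitAt-↑ʳ (6 * κ + (m ∸ 1) * k) 1 0F = refl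

  ownOrOther : ∀ {j j′ : Fin m} → Dec (j ≡ j′) → Fin k → ExtraSymbol
  ownOrOther (yes _)    c = ownSym
  ownOrOther (no j≢j′) c = otherSym (punchOut′ j≢j′) c

  extraEntry : Fin m → Column → ExtraSymbol
  extraEntry j (main g c)   = mainSym g c
  extraEntry j (extra j′ c) = ownOrOther (j Fin.≟ j′) c

  mainSym≢ownOrOther : ∀ {g c j j′ c′} (d : Dec (j ≡ j′)) → mainSym g c ≢ ownOrOther d c′
  mainSym≢ownOrOther (yes _) ()
  mainSym≢ownOrOther (no _)  ()

  otherSym-injective : ∀ {a b c c′} → otherSym a c ≡ otherSym b c′ → a ≡ b × c ≡ c′
  otherSym-injective refl = refl , refl

  ownOrOther-collision : ∀ {j j′ j″ : Fin m} {c c′} (d : Dec (j ≡ j′)) (d′ : Dec (j ≡ j″)) →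
                         ownOrOther d c ≡ ownOrOther d′ c′ →
                         (j′ ≡ j″ × c ≡ c′) ⊎ (j ≡ j′ × j ≡ j″)
  ownOrOther-collision (yes j≡j′) (yes j≡j″) _ = inj₂ (j≡j′ , j≡j″)
  ownOrOther-collision (yes _)    (no _)     ()
  ownOrOther-collision (no _)     (yes _)    ()
  ownOrOther-collision (no j≢j′) (no j≢j″) e with otherSym-injective e
  ... | same , c≡c′ = inj₁ (punchOut′-injective j≢j′ j≢j″ same , c≡c′)

  extraEntry-collision : ∀ j {u v} → u ≢ v → extraEntry j u ≡ extraEntry j v →
                         groupKey u ≡ 6 ↑ʳ j × groupKey v ≡ 6 ↑ʳ j
  extraEntry-collision j {main g c}   {main .g .c}  u≢v refl = ⊥-elim (u≢v refl)
  extraEntry-collision j {main g c}   {extra j′ c′} _ e =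
    ⊥-elim (mainSym≢ownOrOther (j Fin.≟ j′) e)
  extraEntry-collision j {extra j′ c} {main g c′}   _ e =
    ⊥-elim (mainSym≢ownOrOther (j Fin.≟ j′) (sym e))
  extraEntry-collision j {extra j′ c} {extra j″ c′} u≢v e
    with ownOrOther-collision (j Fin.≟ j′) (j Fin.≟ j″) e
  ... | inj₁ (refl , refl) = ⊥-elim (u≢v refl)
  ... | inj₂ (refl , refl) = refl , refl

  mainRow : Fin 6 → Fin K → Fin (3 * κ + m * k + W)
  mainRow r = encodeMain ∘ mainEntry r ∘ decodeColumn

  extraRow : Fin m → Fin K → Fin (6 * κ + (m ∸ 1) * k + 1)
  extraRow j = encodeExtra ∘ extraEntry j ∘ decodeColumn

  array : HHF (6 + m) K (sixThen (6 + m) (3 * κ + m * k + W) (6 * κ + (m ∸ 1) * k + 1))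
  array 0F = mainRow 0F
  array 1F = mainRow 1F
  array 2F = mainRow 2F
  array 3F = mainRow 3F
  array 4F = mainRow 4F
  array 5F = mainRow 5F
  array (suc (suc (suc (suc (suc (suc j)))))) = extraRow j

  array-mainRow : ∀ r {x y} → array (r ↑ˡ m) x ≡ array (r ↑ˡ m) y → mainRow r x ≡ mainRow r y
  array-mainRow 0F e = e
  array-mainRow 1F e = e
  array-mainRow 2F e = e
  array-mainRow 3F e = e
  array-mainRow 4F e = e
  array-mainRow 5F e = e

module _ {κ} {w : Fin 3 → ℕ} (F : HHF 3 κ w) (fractal-F : IsFractal 3 F 3) (m k : ℕ) where
  open Construction F m k

  module Separation {t p} (cols : Fin t → Fin K) (cols-injective : Injective _≡_ _≡_ cols)
                    (cls : Fin t → Fin p) where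

    col : Fin t → Column
    col = decodeColumn ∘ cols

    col-injective : Injective _≡_ _≡_ col
    col-injective = cols-injective ∘ decodeColumn-injective

    split⇒col≢ : ∀ {a b} → cls a ≢ cls b → col a ≢ col b
    split⇒col≢ split same = split (cong cls (col-injective same))

    size : Fin (6 + m) → ℕ
    size q = count (λ a → groupKey (col a) Fin.≟ q)

    record GroupCollision (g : Fin 6) (i : Fin 3) : Set where
      field
        left right           : Fin t
        split                : cls left ≢ cls right
        leftCoord rightCoord : Fin κ
        leftAt               : col left ≡ main g leftCoord
        rightAt              : col right ≡ main g rightCoord
        agree                : F i leftCoord ≡ F i rightCoord

    record Cluster (g : Fin 6) (s : ℕ) : Set where
      field
        member   : Fin s → Fin t
        distinct : Injective _≡_ _≡_ member
        coord    : Fin s → Fin κ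
        located  : ∀ u → col (member u) ≡ main g (coord u)

      coord-injective : Injective _≡_ _≡_ coord
      coord-injective {u} {v} e =
        distinct (col-injective (trans (located u) (trans (cong (main g) e) (sym (located v)))))

    open GroupCollision
    open Cluster

    cluster≤size : ∀ {g s} → Cluster g s → s ≤ size (g ↑ˡ m)
    cluster≤size {g} X = ≤-count (λ a → groupKey (col a) Fin.≟ g ↑ˡ m) (member X) (distinct X)
                                 (cong groupKey ∘ located X)

    record Escape {g s} (X : Cluster g s) : Set where
      field
        index    : Fin t
        position : Fin κ
        at       : col index ≡ main g position
        new      : ∀ u → index ≢ member X u

    extend : ∀ {g s} (X : Cluster g s) → Escape X → Cluster g (suc s)
    extend X e = record
      { member   = Escape.index e ∷ member X
      ; distinct = ∷-injective (Escape.new e) (distinct X)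
      ; coord    = Escape.position e ∷ coord X
      ; located  = λ { zero → Escape.at e ; (suc u) → located X u }
      }

    ∅ : ∀ {g} → Cluster g 0
    ∅ = record { member = [] ; distinct = []-injective ; coord = [] ; located = λ () }

    pairCluster : ∀ {g i} → GroupCollision g i → Cluster g 2
    pairCluster C = extend (extend ∅ rightEscape) leftEscape
      where
      rightEscape = record { index = right C ; position = rightCoord C ; at = rightAt C
                           ; new = λ () }
      leftEscape  = record { index = left C ; position = leftCoord C ; at = leftAt C
                           ; new = λ { 0F e → split C (cong cls e) } }

    InCluster : ∀ {g s} → Cluster g s → Fin t → Set
    InCluster X a = ∃ λ u → a ≡ member X u

    Contains : ∀ {g s i} → Cluster g s → GroupCollision g i → Set
    Contains X C = InCluster X (left C) × InCluster X (right C)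

    absorb : ∀ {g s i} (X : Cluster g s) (C : GroupCollision g i) → Escape X ⊎ Contains X C
    absorb X C with any? (λ u → left C Fin.≟ member X u) | any? (λ u → right C Fin.≟ member X u)
    ... | no out | _ = inj₁ record
      { index = left C ; position = leftCoord C ; at = leftAt C ; new = λ u e → out (u , e) }
    ... | yes _ | no out = inj₁ record
      { index = right C ; position = rightCoord C ; at = rightAt C ; new = λ u e → out (u , e) }
    ... | yes inˡ | yes inʳ = inj₂ (inˡ , inʳ)

    coordAgreement : ∀ {g s i} (X : Cluster g s) (C : GroupCollision g i) → Contains X C →
                     ∃₂ λ u v → u ≢ v × F i (coord X u) ≡ F i (coord X v)
    coordAgreement {g} {i = i} X C ((u , left≡) , (v , right≡)) =
      u , v , u≢v ,
      subst₂ (λ x y → F i x ≡ F i y) (coord≡ (leftAt C) left≡) (coord≡ (rightAt C) right≡) (agree C)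
      where
      u≢v : u ≢ v
      u≢v refl = split C (cong cls (trans left≡ (sym right≡)))
      coord≡ : ∀ {a c u} → col a ≡ main g c → a ≡ member X u → c ≡ coord X u
      coord≡ {u = u} at a≡ = main-injectiveʳ (trans (sym at) (trans (cong col a≡) (located X u)))

    collisions-in-pair⊥ : ∀ {g i j} → i ≢ j → (C : GroupCollision g i) (D : GroupCollision g j) →
                          Contains (pairCluster C) D → ⊥
    collisions-in-pair⊥ {i = i} {j} i≢j C D contains
      with coordAgreement (pairCluster C) C ((0F , refl) , (1F , refl))
         | coordAgreement (pairCluster C) D contains
    ... | _ , _ , u≢v , Fi | _ , _ , u′≢v′ , Fj =
      fractal-agree-at-most-once fractal-F (Finₚ.0≢1+n {i = 0F} ∘ coord-injective X) i≢j
        (Fin2-≢⇒≡ (F i ∘ coord X) u≢v Fi) (Fin2-≢⇒≡ (F j ∘ coord X) u′≢v′ Fj)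
      where X = pairCluster C

    collisions-in-triple⊥ : ∀ {g} (Y : Cluster g 3) →
                            (∀ i → ∃₂ λ u v → u ≢ v × F i (coord Y u) ≡ F i (coord Y v)) → ⊥
    collisions-in-triple⊥ Y collide with proj₁ fractal-F (coord Y) (coord-injective Y) id
    ... | i , separated with collide i
    ... | u , v , u≢v , Fi = separated u v u≢v Fi

    2≤size : ∀ {g i} → GroupCollision g i → 2 ≤ size (g ↑ˡ m)
    2≤size C = cluster≤size (pairCluster C)

    3≤size : ∀ {g i j} → i ≢ j → GroupCollision g i → GroupCollision g j → 3 ≤ size (g ↑ˡ m)
    3≤size i≢j C D with absorb (pairCluster C) D
    ... | inj₁ e        = cluster≤size (extend (pairCluster C) e)
    ... | inj₂ contains = ⊥-elim (collisions-in-pair⊥ i≢j C D contains)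

    triple⇒4≤size : ∀ {g} (Y : Cluster g 3) (C : ∀ i → GroupCollision g i) →
                    Contains Y (C 0F) → 4 ≤ size (g ↑ˡ m)
    triple⇒4≤size Y C contains₀ with absorb Y (C 1F) | absorb Y (C 2F)
    ... | inj₁ e         | _              = cluster≤size (extend Y e)
    ... | inj₂ _         | inj₁ e         = cluster≤size (extend Y e)
    ... | inj₂ contains₁ | inj₂ contains₂ = ⊥-elim (collisions-in-triple⊥ Y λ
      { 0F → coordAgreement Y (C 0F) contains₀
      ; 1F → coordAgreement Y (C 1F) contains₁
      ; 2F → coordAgreement Y (C 2F) contains₂ })

    4≤size : ∀ {g} (C : ∀ i → GroupCollision g i) → 4 ≤ size (g ↑ˡ m)
    4≤size C with absorb (pairCluster (C 0F)) (C 1F)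
    ... | inj₁ e        =
      triple⇒4≤size (extend (pairCluster (C 0F)) e) C ((1F , refl) , (2F , refl))
    ... | inj₂ contains = ⊥-elim (collisions-in-pair⊥ (λ ()) (C 0F) (C 1F) contains)

    flagBound≤size : ∀ g (f₀ f₁ f₂ : Bool) →
                     (T f₀ → GroupCollision g 0F) → (T f₁ → GroupCollision g 1F) →
                     (T f₂ → GroupCollision g 2F) → flagBound f₀ f₁ f₂ ≤ size (g ↑ˡ m)
    flagBound≤size g false false false C₀ C₁ C₂ = z≤n
    flagBound≤size g true  false false C₀ C₁ C₂ = 2≤size (C₀ _)
    flagBound≤size g false true  false C₀ C₁ C₂ = 2≤size (C₁ _)
    flagBound≤size g false false true  C₀ C₁ C₂ = 2≤size (C₂ _)
    flagBound≤size g true  true  false C₀ C₁ C₂ = 3≤size (λ ()) (C₀ _) (C₁ _)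
    flagBound≤size g true  false true  C₀ C₁ C₂ = 3≤size (λ ()) (C₀ _) (C₂ _)
    flagBound≤size g false true  true  C₀ C₁ C₂ = 3≤size (λ ()) (C₁ _) (C₂ _)
    flagBound≤size g true  true  true  C₀ C₁ C₂ = 4≤size λ { 0F → C₀ _ ; 1F → C₁ _ ; 2F → C₂ _ }

    mainRow-collision : ∀ r → Collision array (r ↑ˡ m) cols cls →
                        ∃ λ i → GroupCollision (groupOf r i) i
    mainRow-collision r (a , b , split , same) =
      let (i , c , c′ , at-a , at-b , agreement) =
            mainEntry-collision r (split⇒col≢ split) (encodeMain-injective (array-mainRow r same))
      in i , record { left = a ; right = b ; split = split ; leftCoord = c ; rightCoord = c′
                    ; leftAt = at-a ; rightAt = at-b ; agree = agreement }

    extraRow-collision : ∀ j → Collision array (6 ↑ʳ j) cols cls → 2 ≤ size (6 ↑ʳ j)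
    extraRow-collision j (a , b , split , same) =
      let (at-a , at-b) = extraEntry-collision j (split⇒col≢ split) (encodeExtra-injective same)
      in ≤-count (λ x → groupKey (col x) Fin.≟ 6 ↑ʳ j) (a ∷ b ∷ [])
                 (pair-injective (split ∘ cong cls)) λ { 0F → at-a ; 1F → at-b }

    module _ (collide : ∀ r → Collision array r cols cls) where

      witnessRow : Fin 6 → Fin 3
      witnessRow r = proj₁ (mainRow-collision r (collide (r ↑ˡ m)))

      flagged : ∀ g i → T (flag witnessRow g i) → GroupCollision g i
      flagged g i f = subst (λ g → GroupCollision g i) (groupOf-rowOf g i)
        (subst (λ i′ → GroupCollision (groupOf r i′) i′) (toWitness f)
          (proj₂ (mainRow-collision r (collide (r ↑ˡ m)))))
        where r = rowOf g i

      9+m*2≤t : 9 + m * 2 ≤ t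
      9+m*2≤t = begin
        9 + m * 2                                            ≤⟨ +-mono-≤ main≥9 (∑-≥ 2 extra≥2) ⟩
        groupBoundSum witnessRow + ∑[ j < m ] size (6 ↑ʳ j) ≤⟨ +-mono-≤ (∑-mono-≤ main≥) ≤-refl ⟩
        ∑[ g < 6 ] size (g ↑ˡ m) + ∑[ j < m ] size (6 ↑ʳ j) ≡⟨ ∑-↑ 6 size ⟨
        ∑[ q < 6 + m ] size q                                ≡⟨ ∑-count-fibres (groupKey ∘ col) ⟩
        t                                                    ∎
        where
        open ℕₚ.≤-Reasoning
        main≥9 = 9≤groupBoundSum witnessRow
        extra≥2 = λ j → extraRow-collision j (collide (6 ↑ʳ j))
        main≥ = λ g → flagBound≤size g _ _ _ (flagged g 0F) (flagged g 1F) (flagged g 2F)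

  array-isDHHF : ∀ {t p} → t ≤ 8 + m * 2 → IsDHHF array t p
  array-isDHHF t≤8+m*2 cols cols-injective cls
    with ∃⊎∀ (λ r → separates-or-collides array r cols cls)
  ... | inj₁ separated = separated
  ... | inj₂ collide   =
    ⊥-elim (ℕₚ.<⇒≱ (s≤s t≤8+m*2) (Separation.9+m*2≤t cols cols-injective cls collide))

2[6+m]∸4≡8+m*2 : ∀ m → 2 * (6 + m) ∸ 4 ≡ 8 + m * 2
2[6+m]∸4≡8+m*2 m = trans (cong (_∸ 4) (doubling m)) (ℕₚ.m+n∸m≡n 4 (8 + m * 2))
  where
  doubling : ∀ m → 2 * (6 + m) ≡ 4 + (8 + m * 2)
  doubling = ℕ-Solver.solve-∀

phhf-exists : ∀ {κ} {w : Fin 3 → ℕ} (F : HHF 3 κ w) → IsFractal 3 F 3 → ∀ m k →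
              PHHFExists (6 + m) (6 * κ + m * k)
                (sixThen (6 + m) (3 * κ + m * k + (w 0F + w 1F + w 2F)) (6 * κ + (m ∸ 1) * k + 1))
                (2 * (6 + m) ∸ 4)
phhf-exists F fractal-F m k =
  Construction.array F m k , array-isDHHF F fractal-F m k (ℕₚ.≤-reflexive (2[6+m]∸4≡8+m*2 m))

+-∸ : ∀ {m n} → n ≤ m → + (m ∸ n) ≡ + m ℤ.- + n
+-∸ {m} {n} n≤m = trans (sym (⊖-≥ n≤m)) (sym (m-n≡m⊖n m n))

+-affine : ∀ a x b y → + (a * x + b * y) ≡ + a ℤ.* + x ℤ.+ + b ℤ.* + y
+-affine a x b y = trans (pos-+ (a * x) (b * y)) (cong₂ ℤ._+_ (pos-* a x) (pos-* b y))

+-3*[6+m] : ∀ m → + (3 * (6 + m)) ≡ + 3 ℤ.* (+ 6 ℤ.+ + m)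
+-3*[6+m] m = trans (pos-* 3 (6 + m)) (cong (+ 3 ℤ.*_) (pos-+ 6 m))

Kℤ : (n κ W : ℕ) → ℤ
Kℤ n κ W = (+ (3 * n) ℤ.- + 12) ℤ.* + κ ℤ.- (+ n ℤ.- + 6) ℤ.* (+ W ℤ.- + 1)

Vℤ : (n κ W : ℕ) → ℤ
Vℤ n κ W = (+ (3 * n) ℤ.- + 15) ℤ.* + κ ℤ.- (+ n ℤ.- + 7) ℤ.* (+ W ℤ.- + 1) ℤ.+ + 1

K-identity : ∀ κ W m →
  + 6 ℤ.* κ ℤ.+ m ℤ.* (+ 3 ℤ.* κ ℤ.+ + 1 ℤ.- W)
  ≡ (+ 3 ℤ.* (+ 6 ℤ.+ m) ℤ.- + 12) ℤ.* κ ℤ.- (+ 6 ℤ.+ m ℤ.- + 6) ℤ.* (W ℤ.- + 1)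
K-identity = solve-∀

V-identity-main : ∀ κ W m →
  + 3 ℤ.* κ ℤ.+ m ℤ.* (+ 3 ℤ.* κ ℤ.+ + 1 ℤ.- W) ℤ.+ W
  ≡ (+ 3 ℤ.* (+ 6 ℤ.+ m) ℤ.- + 15) ℤ.* κ ℤ.- (+ 6 ℤ.+ m ℤ.- + 7) ℤ.* (W ℤ.- + 1) ℤ.+ + 1
V-identity-main = solve-∀

V-identity-extra : ∀ κ W m →
  + 6 ℤ.* κ ℤ.+ (m ℤ.- + 1) ℤ.* (+ 3 ℤ.* κ ℤ.+ + 1 ℤ.- W) ℤ.+ + 1
  ≡ (+ 3 ℤ.* (+ 6 ℤ.+ m) ℤ.- + 15) ℤ.* κ ℤ.- (+ 6 ℤ.+ m ℤ.- + 7) ℤ.* (W ℤ.- + 1) ℤ.+ + 1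
V-identity-extra = solve-∀

module SymbolCounts {κ W : ℕ} (W≤κ : W ≤ κ) where
  open ≡-Reasoning

  -- The k for which main rows (3κ + mk + W symbols) and extra rows (6κ + (m − 1)k + 1) agree.
  k : ℕ
  k = 3 * κ + 1 ∸ W

  +k : + k ≡ + 3 ℤ.* + κ ℤ.+ + 1 ℤ.- + W
  +k = trans (+-∸ (ℕₚ.≤-trans W≤κ (ℕₚ.≤-trans (ℕₚ.m≤n*m κ 3) (ℕₚ.m≤m+n (3 * κ) 1))))
             (cong (ℤ._- + W) (+-affine 3 κ 1 1))

  uncast-6+m : ∀ m (f : ℤ → ℤ → ℤ) →
               f (+ 3 ℤ.* (+ 6 ℤ.+ + m)) (+ 6 ℤ.+ + m) ≡ f (+ (3 * (6 + m))) (+ (6 + m))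
  uncast-6+m m f = sym (cong₂ f (+-3*[6+m] m) (pos-+ 6 m))

  K-value : ∀ m → + (6 * κ + m * k) ≡ Kℤ (6 + m) κ W
  K-value m = begin
    + (6 * κ + m * k)                 ≡⟨ +-affine 6 κ m k ⟩
    + 6 ℤ.* + κ ℤ.+ + m ℤ.* + k       ≡⟨ cong (λ x → + 6 ℤ.* + κ ℤ.+ + m ℤ.* x) +k ⟩
    _                                 ≡⟨ K-identity (+ κ) (+ W) (+ m) ⟩
    _ ≡⟨ uncast-6+m m (λ 3n n → (3n ℤ.- + 12) ℤ.* + κ ℤ.- (n ℤ.- + 6) ℤ.* (+ W ℤ.- + 1)) ⟩
    Kℤ (6 + m) κ W                    ∎

  V-value-main : ∀ m → + (3 * κ + m * k + W) ≡ Vℤ (6 + m) κ W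
  V-value-main m = begin
    + (3 * κ + m * k + W)                  ≡⟨ pos-+ (3 * κ + m * k) W ⟩
    + (3 * κ + m * k) ℤ.+ + W              ≡⟨ cong (ℤ._+ + W) (+-affine 3 κ m k) ⟩
    + 3 ℤ.* + κ ℤ.+ + m ℤ.* + k ℤ.+ + W    ≡⟨ cong (λ x → + 3 ℤ.* + κ ℤ.+ + m ℤ.* x ℤ.+ + W) +k ⟩
    _                                      ≡⟨ V-identity-main (+ κ) (+ W) (+ m) ⟩
    _ ≡⟨ uncast-6+m m (λ 3n n → (3n ℤ.- + 15) ℤ.* + κ ℤ.- (n ℤ.- + 7) ℤ.* (+ W ℤ.- + 1) ℤ.+ + 1) ⟩
    Vℤ (6 + m) κ W                         ∎

  V-value-extra : ∀ {m} → 1 ≤ m → + (6 * κ + (m ∸ 1) * k + 1) ≡ Vℤ (6 + m) κ W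
  V-value-extra {m} 1≤m = begin
    + (6 * κ + (m ∸ 1) * k + 1)                ≡⟨ pos-+ (6 * κ + (m ∸ 1) * k) 1 ⟩
    + (6 * κ + (m ∸ 1) * k) ℤ.+ + 1            ≡⟨ cong (ℤ._+ + 1) (+-affine 6 κ (m ∸ 1) k) ⟩
    + 6 ℤ.* + κ ℤ.+ + (m ∸ 1) ℤ.* + k ℤ.+ + 1
      ≡⟨ cong₂ (λ x y → + 6 ℤ.* + κ ℤ.+ x ℤ.* y ℤ.+ + 1) (+-∸ 1≤m) +k ⟩
    _                                          ≡⟨ V-identity-extra (+ κ) (+ W) (+ m) ⟩
    _ ≡⟨ uncast-6+m m (λ 3n n → (3n ℤ.- + 15) ℤ.* + κ ℤ.- (n ℤ.- + 7) ℤ.* (+ W ℤ.- + 1) ℤ.+ + 1) ⟩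
    Vℤ (6 + m) κ W                             ∎

phf-exists : ∀ {κ} {w : Fin 3 → ℕ} (F : HHF 3 κ w) → IsFractal 3 F 3 → ∀ m →
             let W = w 0F + w 1F + w 2F in
             W ≤ κ → (K V : ℕ) → + K ≡ Kℤ (6 + m) κ W → + V ≡ Vℤ (6 + m) κ W →
             PHFExists (6 + m) K V (2 * (6 + m) ∸ 4)
phf-exists F fractal-F m W≤κ K V K≡ V≡ =
  subst (λ K → PHFExists (6 + m) K V (2 * (6 + m) ∸ 4)) (+-injective (trans (K-value m) (sym K≡)))
    (PHHFExists-mono (sixThen-≤ main≤V extra≤V) (phhf-exists F fractal-F m k))
  where
  open SymbolCounts W≤κ
  main≤V = ℕₚ.≤-reflexive (+-injective (trans (V-value-main m) (sym V≡)))
  extra≤V = λ 7≤6+m →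
    ℕₚ.≤-reflexive (+-injective (trans (V-value-extra (ℕₚ.+-cancelˡ-≤ 6 1 m 7≤6+m)) (sym V≡)))

lemma22 : (κ w₁ w₂ w₃ n : ℕ) → FractalPHHF3Exists κ w₁ w₂ w₃ → 6 ≤ n →
    ((k : ℕ) → 1 ≤ k →
      PHHFExists n (6 * κ + (n ∸ 6) * k)
        (sixThen n (3 * κ + (n ∸ 6) * k + (w₁ + w₂ + w₃))
                   (6 * κ + (n ∸ 7) * k + 1))
        (2 * n ∸ 4))
    × (w₁ + w₂ + w₃ ≤ κ → (K V : ℕ) →
        + K ≡ (+ (3 * n) ℤ.- + 12) ℤ.* + κ
              ℤ.- (+ n ℤ.- + 6) ℤ.* (+ (w₁ + w₂ + w₃) ℤ.- + 1) →
        + V ≡ (+ (3 * n) ℤ.- + 15) ℤ.* + κ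
              ℤ.- (+ n ℤ.- + 7) ℤ.* (+ (w₁ + w₂ + w₃) ℤ.- + 1) ℤ.+ + 1 →
        PHFExists n K V (2 * n ∸ 4))
-- Part (i) holds for every k, including k = 0.
lemma22 κ w₁ w₂ w₃ n (F , fractal-F) 6≤n with ℕₚ.m≤n⇒∃[o]m+o≡n 6≤n
... | m , refl = (λ k _ → phhf-exists F fractal-F m k) , phf-exists F fractal-F m
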